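{- Let $(a_n)_{n\ge0}$ be a sequence of complex numbers with $a_0=0$, let $b_n=a_n-a_{n-1}$ for $n\ge1$, and for integers $k\ge0$ set $$\Phi_k(x)=\sum_{n\ge1}a_n n^k x^n,\qquad \varphi_k(x)=\sum_{n\ge1}b_n n^k x^n .$$ Then for every integer $k\ge0$, as formal power series in $x$, $$\Phi_k(x)=\varphi_k(x)+\sum_{j=0}^k\binom{k}{j}\mathrm{Li}_{j-k}(x)\,\varphi_j(x).$$
   Context: $\mathrm{Li}_s(x)=\sum_{n\ge1}x^n n^{ -s}$ is the polylogarithm; for nonpositive integers $s$ it is a rational function of $x$ (e.g. $\mathrm{Li}_0(x)=x/(1-x)$). -}

module Defs where

open import Level using (Level)
open import Data.Nat using (ℕ; zero; suc)
import Data.Nat as ℕ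
open import Data.Nat.Combinatorics using (_C_)
open import Algebra.Bundles using (CommutativeRing)

-- Formal power series over a commutative ring R, represented by their
-- coefficient sequences ℕ → Carrier; equality is coefficientwise ≈.
module FPS {c ℓ : Level} (R : CommutativeRing c ℓ) where
  open CommutativeRing R public hiding (zero)

  Series : Set c
  Series = ℕ → Carrier

  ι : ℕ → Carrier
  ι zero    = 0#
  ι (suc n) = 1# + ι n

  pow : Carrier → ℕ → Carrier
  pow x zero    = 1#
  pow x (suc m) = x * pow x m

  sumUpTo : ℕ → (ℕ → Carrier) → Carrier
  sumUpTo zero    f = f zero
  sumUpTo (suc N) f = sumUpTo N f + f (suc N)

  _⊕_ : Series → Series → Series
  (f ⊕ g) n = f n + g n

  _⊗_ : Series → Series → Series
  (f ⊗ g) N = sumUpTo N (λ i → f i * g (N ℕ.∸ i))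

  _·_ : Carrier → Series → Series
  (r · f) n = r * f n

  ΣS : ℕ → (ℕ → Series) → Series
  ΣS k F n = sumUpTo k (λ j → F j n)

  _≋_ : Series → Series → Set ℓ
  f ≋ g = ∀ n → f n ≈ g n

  -- Li_{-m}(x) = Σ_{n≥1} n^m x^n   (m ≥ 0), as a formal power series
  LiNeg : ℕ → Series
  LiNeg m zero    = 0#
  LiNeg m (suc n) = pow (ι (suc n)) m

  -- b_n = a_n − a_{n−1} for n ≥ 1 (b_0 unused; set to 0)
  diffSeq : (ℕ → Carrier) → (ℕ → Carrier)
  diffSeq a zero    = 0#
  diffSeq a (suc n) = a (suc n) + (- a n)

  weighted : (ℕ → Carrier) → ℕ → Series
  weighted c k zero    = 0#
  weighted c k (suc n) = c (suc n) * pow (ι (suc n)) k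

  Φ : (ℕ → Carrier) → ℕ → Series
  Φ a k = weighted a k

  φ : (ℕ → Carrier) → ℕ → Series
  φ a k = weighted (diffSeq a) k

{-# OPTIONS --safe #-}
module Submission where

-- With θ = x d/dx we have Φ_k = θ^k A, φ_k = θ^k B and Li_{-m} = θ^m Li₀, where
-- A = Σ aₙxⁿ and B = Σ bₙxⁿ. Since a₀ = 0, A = B/(1 − x) = B + Li₀ B. As θ is a
-- derivation, θ^k obeys the Leibniz rule θ^k(FG) = Σⱼ C(k,j) θ^(k−j)F θ^j G;
-- coefficientwise this is the binomial expansion of n^k = ((n − i) + i)^k.
-- Applying θ^k to A = B + Li₀ B gives the identity.

open import Defs
open import Level using (Level)
open import Data.Nat using (ℕ; zero; suc; _∸_; _≤_)
import Data.Nat as ℕ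
open import Data.Nat.Properties using (m∸n+n≡m)
open import Data.Nat.Combinatorics using (_C_)
open import Data.Fin using (toℕ)
open import Data.Fin.Properties using (toℕ≤pred[n])
open import Algebra.Bundles using (CommutativeRing)
open import Function.Indexed.Relation.Binary.Equality using (≡-setoid)
open import Relation.Binary.Bundles using (Setoid)
import Relation.Binary.Indexed.Heterogeneous.Construct.Trivial as Trivial
open import Relation.Binary.PropositionalEquality as ≡ using (_≡_)
import Relation.Binary.Reasoning.Setoid as SetoidReasoning

module SeriesProperties {c ℓ : Level} (R : CommutativeRing c ℓ) where
  open FPS R
  open import Algebra.Properties.Semiring.Exp semiring using (_^_; ^-congˡ)
  open import Algebra.Properties.Semiring.Mult semiring using (_×_; ×-congʳ; ×-homo-+; ×-assoc-*)
  open import Algebra.Properties.Semiring.Sum semiring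
    using (sum⁺-syntax; *-distribˡ-sum; *-distribʳ-sum; sum-cong-≋; ∑-comm)
  open import Algebra.Properties.CommutativeSemigroup *-commutativeSemigroup using (interchange)
  open import Algebra.Properties.Group +-group using (//-rightDividesˡ)
  import Algebra.Properties.CommutativeSemiring.Binomial commutativeSemiring as Binomial
  open SetoidReasoning setoid

  pow≡^ : ∀ x n → pow x n ≡ x ^ n
  pow≡^ x zero    = ≡.refl
  pow≡^ x (suc n) = ≡.cong (x *_) (pow≡^ x n)

  ι≡×1# : ∀ n → ι n ≡ n × 1#
  ι≡×1# zero    = ≡.refl
  ι≡×1# (suc n) = ≡.cong (1# +_) (ι≡×1# n)

  ι-+ : ∀ m n → ι (m ℕ.+ n) ≈ ι m + ι n
  ι-+ m n rewrite ι≡×1# (m ℕ.+ n) | ι≡×1# m | ι≡×1# n = ×-homo-+ 1# m n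

  ×≈ι* : ∀ n x → n × x ≈ ι n * x
  ×≈ι* n x rewrite ι≡×1# n = begin
    n × x          ≈⟨ ×-congʳ n (*-identityˡ x) ⟨
    n × (1# * x)   ≈⟨ ×-assoc-* n 1# x ⟨
    n × 1# * x     ∎

  sumUpTo-cong : ∀ N {f g : ℕ → Carrier} → (∀ i → f i ≈ g i) → sumUpTo N f ≈ sumUpTo N g
  sumUpTo-cong zero    f≈g = f≈g 0
  sumUpTo-cong (suc N) f≈g = +-cong (sumUpTo-cong N f≈g) (f≈g (suc N))

  sumUpTo-shift : ∀ N (f : ℕ → Carrier) → sumUpTo (suc N) f ≈ f 0 + sumUpTo N (λ i → f (suc i))
  sumUpTo-shift zero    f = refl
  sumUpTo-shift (suc N) f = trans (+-congʳ (sumUpTo-shift N f)) (+-assoc _ _ _)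

  sumUpTo≈∑ : ∀ N (f : ℕ → Carrier) → sumUpTo N f ≈ ∑[ i ≤ N ] f (toℕ i)
  sumUpTo≈∑ zero    f = sym (+-identityʳ (f 0))
  sumUpTo≈∑ (suc N) f = trans (sumUpTo-shift N f) (+-congˡ (sumUpTo≈∑ N (λ i → f (suc i))))

  pow-ι-binomial : ∀ {i n} → i ≤ n → ∀ k →
    ι n ^ k ≈ ∑[ j ≤ k ] ((k C toℕ j) × (ι (n ∸ i) ^ toℕ j * ι i ^ (k ∸ toℕ j)))
  pow-ι-binomial {i} {n} i≤n k = begin
    ι n ^ k                  ≡⟨ ≡.cong (λ m → ι m ^ k) (m∸n+n≡m i≤n) ⟨
    ι (n ∸ i ℕ.+ i) ^ k      ≈⟨ ^-congˡ k (ι-+ (n ∸ i) i) ⟩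
    (ι (n ∸ i) + ι i) ^ k    ≈⟨ Binomial.theorem k (ι (n ∸ i)) (ι i) ⟩
    Binomial.binomialExpansion (ι (n ∸ i)) (ι i) k ∎

  ≋-setoid : Setoid c ℓ
  ≋-setoid = ≡-setoid ℕ (Trivial.indexedSetoid setoid)

  module ≋-Reasoning = SetoidReasoning ≋-setoid

  ⊕-cong : ∀ {f f′ g g′} → f ≋ f′ → g ≋ g′ → (f ⊕ g) ≋ (f′ ⊕ g′)
  ⊕-cong f≋f′ g≋g′ n = +-cong (f≋f′ n) (g≋g′ n)

  ⊕-congˡ : ∀ {f g g′} → g ≋ g′ → (f ⊕ g) ≋ (f ⊕ g′)
  ⊕-congˡ g≋g′ n = +-congˡ (g≋g′ n)

  ⊗-cong : ∀ {f f′ g g′} → f ≋ f′ → g ≋ g′ → (f ⊗ g) ≋ (f′ ⊗ g′)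
  ⊗-cong f≋f′ g≋g′ n = sumUpTo-cong n (λ i → *-cong (f≋f′ i) (g≋g′ (n ∸ i)))

  ·-congˡ : ∀ r {f g} → f ≋ g → (r · f) ≋ (r · g)
  ·-congˡ r f≋g n = *-congˡ (f≋g n)

  ΣS-cong : ∀ k {F G : ℕ → Series} → (∀ j → F j ≋ G j) → ΣS k F ≋ ΣS k G
  ΣS-cong k F≋G n = sumUpTo-cong k (λ j → F≋G j n)

  θ^ : ℕ → Series → Series
  θ^ k f n = ι n ^ k * f n

  θ^-cong : ∀ k {f g} → f ≋ g → θ^ k f ≋ θ^ k g
  θ^-cong k f≋g n = *-congˡ (f≋g n)

  θ^-distrib-⊕ : ∀ k f g → θ^ k (f ⊕ g) ≋ (θ^ k f ⊕ θ^ k g)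
  θ^-distrib-⊕ k f g n = distribˡ (ι n ^ k) (f n) (g n)

  θ^-leibniz : ∀ k f g → θ^ k (f ⊗ g) ≋ ΣS k (λ j → ι (k C j) · (θ^ (k ∸ j) f ⊗ θ^ j g))
  θ^-leibniz k f g n = begin
    ι n ^ k * sumUpTo n (λ i → f i * g (n ∸ i))
      ≈⟨ *-congˡ (sumUpTo≈∑ n (λ i → f i * g (n ∸ i))) ⟩
    ι n ^ k * ∑[ i ≤ n ] (f (toℕ i) * g (n ∸ toℕ i))
      ≈⟨ *-distribˡ-sum {suc n} (ι n ^ k) (λ i → f (toℕ i) * g (n ∸ toℕ i)) ⟩
    ∑[ i ≤ n ] (ι n ^ k * (f (toℕ i) * g (n ∸ toℕ i)))
      ≈⟨ sum-cong-≋ {suc n} (λ i → expand (toℕ≤pred[n] i)) ⟩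
    ∑[ i ≤ n ] ∑[ j ≤ k ] term (toℕ i) (toℕ j)
      ≈⟨ ∑-comm {suc n} {suc k} (λ i j → term (toℕ i) (toℕ j)) ⟩
    ∑[ j ≤ k ] ∑[ i ≤ n ] term (toℕ i) (toℕ j)
      ≈⟨ sum-cong-≋ {suc k} (λ j →
           *-distribˡ-sum {suc n} (ι (k C toℕ j)) (λ i → convolutionTerm (toℕ j) (toℕ i))) ⟨
    ∑[ j ≤ k ] (ι (k C toℕ j) * ∑[ i ≤ n ] convolutionTerm (toℕ j) (toℕ i))
      ≈⟨ sum-cong-≋ {suc k} (λ j →
           *-congˡ {ι (k C toℕ j)} (sumUpTo≈∑ n (convolutionTerm (toℕ j)))) ⟨
    ∑[ j ≤ k ] (ι (k C toℕ j) * sumUpTo n (convolutionTerm (toℕ j)))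
      ≈⟨ sumUpTo≈∑ k (λ j → ι (k C j) * sumUpTo n (convolutionTerm j)) ⟨
    ΣS k (λ j → ι (k C j) · (θ^ (k ∸ j) f ⊗ θ^ j g)) n ∎
    where
    convolutionTerm : ℕ → ℕ → Carrier
    convolutionTerm j i = θ^ (k ∸ j) f i * θ^ j g (n ∸ i)

    term : ℕ → ℕ → Carrier
    term i j = ι (k C j) * convolutionTerm j i

    rearrange : ∀ i j → (k C j) × (ι (n ∸ i) ^ j * ι i ^ (k ∸ j)) * (f i * g (n ∸ i)) ≈ term i j
    rearrange i j = begin
      (k C j) × (ι (n ∸ i) ^ j * ι i ^ (k ∸ j)) * (f i * g (n ∸ i))
        ≈⟨ ×-assoc-* (k C j) _ _ ⟩
      (k C j) × ((ι (n ∸ i) ^ j * ι i ^ (k ∸ j)) * (f i * g (n ∸ i)))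
        ≈⟨ ×-congʳ (k C j) (*-congʳ (*-comm _ _)) ⟩
      (k C j) × ((ι i ^ (k ∸ j) * ι (n ∸ i) ^ j) * (f i * g (n ∸ i)))
        ≈⟨ ×-congʳ (k C j) (interchange _ _ _ _) ⟩
      (k C j) × (θ^ (k ∸ j) f i * θ^ j g (n ∸ i))
        ≈⟨ ×≈ι* (k C j) _ ⟩
      term i j ∎

    expand : ∀ {i} → i ≤ n → ι n ^ k * (f i * g (n ∸ i)) ≈ ∑[ j ≤ k ] term i (toℕ j)
    expand {i} i≤n = begin
      ι n ^ k * (f i * g (n ∸ i))
        ≈⟨ *-congʳ (pow-ι-binomial i≤n k) ⟩
      Binomial.binomialExpansion (ι (n ∸ i)) (ι i) k * (f i * g (n ∸ i))
        ≈⟨ *-distribʳ-sum {suc k} (f i * g (n ∸ i)) (Binomial.binomialTerm (ι (n ∸ i)) (ι i) k) ⟩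
      ∑[ j ≤ k ] ((k C toℕ j) × (ι (n ∸ i) ^ toℕ j * ι i ^ (k ∸ toℕ j)) * (f i * g (n ∸ i)))
        ≈⟨ sum-cong-≋ {suc k} (λ j → rearrange i (toℕ j)) ⟩
      ∑[ j ≤ k ] term i (toℕ j) ∎

  weighted≋θ^ : ∀ (a : ℕ → Carrier) → a 0 ≈ 0# → ∀ k → weighted a k ≋ θ^ k a
  weighted≋θ^ a a₀≈0 k zero    = sym (trans (*-congˡ a₀≈0) (zeroʳ _))
  weighted≋θ^ a a₀≈0 k (suc n) = trans (*-comm _ _) (*-congʳ (reflexive (pow≡^ (ι (suc n)) k)))

  LiNeg≋θ^LiNeg0 : ∀ m → LiNeg m ≋ θ^ m (LiNeg 0)
  LiNeg≋θ^LiNeg0 m zero    = sym (zeroʳ _)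
  LiNeg≋θ^LiNeg0 m (suc n) = trans (reflexive (pow≡^ (ι (suc n)) m)) (sym (*-identityʳ _))

  sumUpTo-diffSeq : ∀ (a : ℕ → Carrier) → a 0 ≈ 0# → ∀ n → sumUpTo n (λ i → diffSeq a (n ∸ i)) ≈ a n
  sumUpTo-diffSeq a a₀≈0 zero    = sym a₀≈0
  sumUpTo-diffSeq a a₀≈0 (suc n) = begin
    sumUpTo (suc n) (λ i → diffSeq a (suc n ∸ i))
      ≈⟨ sumUpTo-shift n _ ⟩
    diffSeq a (suc n) + sumUpTo n (λ i → diffSeq a (n ∸ i))
      ≈⟨ +-congˡ (sumUpTo-diffSeq a a₀≈0 n) ⟩
    (a (suc n) - a n) + a n
      ≈⟨ //-rightDividesˡ (a n) (a (suc n)) ⟩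
    a (suc n) ∎

  diffSeq-summation : ∀ (a : ℕ → Carrier) → a 0 ≈ 0# → a ≋ (diffSeq a ⊕ (LiNeg 0 ⊗ diffSeq a))
  diffSeq-summation a a₀≈0 zero    = trans a₀≈0 (sym (trans (+-identityˡ _) (zeroˡ _)))
  diffSeq-summation a a₀≈0 (suc n) = begin
    a (suc n)
      ≈⟨ sumUpTo-diffSeq a a₀≈0 (suc n) ⟨
    sumUpTo (suc n) (λ i → b (suc n ∸ i))
      ≈⟨ sumUpTo-shift n _ ⟩
    b (suc n) + sumUpTo n (λ i → b (n ∸ i))
      ≈⟨ +-congˡ dropLeadingTerm ⟨
    b (suc n) + (0# * b (suc n) + sumUpTo n (λ i → 1# * b (n ∸ i)))
      ≈⟨ +-congˡ (sumUpTo-shift n _) ⟨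
    b (suc n) + (LiNeg 0 ⊗ b) (suc n) ∎
    where
    b : ℕ → Carrier
    b = diffSeq a

    dropLeadingTerm : 0# * b (suc n) + sumUpTo n (λ i → 1# * b (n ∸ i)) ≈ sumUpTo n (λ i → b (n ∸ i))
    dropLeadingTerm =
      trans (+-congʳ (zeroˡ _)) (trans (+-identityˡ _) (sumUpTo-cong n (λ i → *-identityˡ _)))

theorem10 : {c ℓ : Level} (R : CommutativeRing c ℓ) →
    let open FPS R in
    (a : ℕ → Carrier) → a 0 ≈ 0# → (k : ℕ) →
    Φ a k ≋ (φ a k ⊕ ΣS k (λ j → ι (k C j) · (LiNeg (k ∸ j) ⊗ φ a j)))
theorem10 R a a₀≈0 k = begin
  Φ a k                                  ≈⟨ weighted≋θ^ a a₀≈0 k ⟩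
  θ^ k a                                 ≈⟨ θ^-cong k (diffSeq-summation a a₀≈0) ⟩
  θ^ k (b ⊕ (LiNeg 0 ⊗ b))               ≈⟨ θ^-distrib-⊕ k b (LiNeg 0 ⊗ b) ⟩
  θ^ k b ⊕ θ^ k (LiNeg 0 ⊗ b)            ≈⟨ ⊕-congˡ (θ^-leibniz k (LiNeg 0) b) ⟩
  θ^ k b ⊕ ΣS k (λ j → ι (k C j) · (θ^ (k ∸ j) (LiNeg 0) ⊗ θ^ j b))
    ≈⟨ ⊕-cong (weighted≋θ^ b refl k)
              (ΣS-cong k (λ j → ·-congˡ (ι (k C j))
                (⊗-cong (LiNeg≋θ^LiNeg0 (k ∸ j)) (weighted≋θ^ b refl j)))) ⟨
  φ a k ⊕ ΣS k (λ j → ι (k C j) · (LiNeg (k ∸ j) ⊗ φ a j)) ∎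
  where
  open FPS R
  open SeriesProperties R
  open ≋-Reasoning
  b : ℕ → Carrier
  b = diffSeq a
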